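{- Let $d>1$ be an integer such that $d=D_S(n)$ for some $n\ge1$. Then $d=p^m$ for some prime $p$ with $p=2$ or $p>3$ and some integer $m\ge1$. Moreover, if $p>3$, then $\mathrm{ord}_9(p^m)=\varphi(p^m)/2$ and $\mathrm{ord}_9(p)=(p-1)/2$, and if in addition $m\ge2$ then $3^{p-1}\not\equiv 1\pmod{p^2}$.
   Context: The Salajan sequence is $u_1,u_2,\ldots$ with $u_j=(3^j-5(-1)^j)/4$ for $j\ge1$; its terms are distinct. For $n\ge1$, $D_S(n)$ is the smallest positive integer $m$ such that $u_1,\ldots,u_n$ are pairwise incongruent modulo $m$. For an integer $N$ coprime to $3$, $\mathrm{ord}_9(N)$ is the multiplicative order of $9$ modulo $N$; $\varphi$ is Euler's totient function. -}

module Defs where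

open import Data.Nat as ℕ using (ℕ; zero; suc; _≤_; _<_)
open import Data.Nat.Coprimality using (Coprime; coprime?)
open import Data.Integer as ℤ using (ℤ; +_; -_)
open import Data.Integer.Divisibility using (_∣_)
open import Data.List using (List; filter; length)
open import Data.List using (upTo)
open import Data.Product using (_×_)
open import Relation.Nullary using (¬_)

-- Salajan sequence (indexed from j = 1; u 0 is an unused junk value):
-- u j = (3^j - 5(-1)^j) / 4, an exact integer division.
u : ℕ → ℤ
u j = ((+ 3) ℤ.^ j ℤ.- (+ 5) ℤ.* ((- (+ 1)) ℤ.^ j)) ℤ./ (+ 4)

PairwiseIncongruent : ℕ → ℕ → Set
PairwiseIncongruent n m =
  ∀ i j → 1 ≤ i → i ≤ n → 1 ≤ j → j ≤ n → i ≢ j → ¬ ((+ m) ∣ (u i ℤ.- u j))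
  where open import Relation.Binary.PropositionalEquality using (_≢_)

IsDS : ℕ → ℕ → Set
IsDS n d = 1 ≤ d × PairwiseIncongruent n d
         × (∀ m → 1 ≤ m → m < d → ¬ PairwiseIncongruent n m)

IsOrd9 : ℕ → ℕ → Set
IsOrd9 N k = 1 ≤ k × (+ N) ∣ ((+ 9) ℤ.^ k ℤ.- + 1)
           × (∀ j → 1 ≤ j → j < k → ¬ ((+ N) ∣ ((+ 9) ℤ.^ j ℤ.- + 1)))

φ : ℕ → ℕ
φ N = length (filter (λ k → coprime? (suc k) N) (upTo N))

module Submission where

open import Defs
open import Data.Nat using (ℕ; _≤_; _<_; _^_; _∸_; _/_; _*_)
open import Data.Nat.Primality using (Prime)
open import Data.Integer as ℤ using (+_)
open import Data.Integer.Divisibility as ℤd using ()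
open import Data.Product using (_×_; ∃; ∃-syntax)
open import Data.Sum using (_⊎_)
open import Relation.Binary.PropositionalEquality using (_≡_)
open import Relation.Nullary using (¬_)

open import Data.Nat
open import Data.Nat.Properties
open import Data.Nat.Divisibility
open import Data.Nat.DivMod using (m*n/n≡m)
open import Data.Nat.Coprimality using (Coprime; coprime?; coprime-divisor)
import Data.Nat.Coprimality as Coprime
open import Data.Nat.GCD using (gcd; gcd-GCD; gcd[m,n]∣m; gcd[m,n]∣n; gcd[m,n]≢0; module Bézout)
open import Data.Nat.Primality using (euclidsLemma; prime⇒irreducible; prime[2])
open import Data.Nat.Primality.Factorisation using (factorise)
open import Data.Nat.Combinatorics using (_C_; nCn≡1; nC1≡n; nCk+nC[k+1]≡[n+1]C[k+1])
open import Data.Nat.Induction using (<-rec)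
open import Data.Nat.ListAction using (product)
open import Data.Nat.Tactic.RingSolver using (solve-∀)
open import Data.Integer using (-_)
import Data.Integer.Properties as ℤ
open import Data.Integer.Tactic.RingSolver as ℤ-Solver using ()
open import Data.Fin using (toℕ; fromℕ; inject₁)
import Data.Fin as Fin
open import Data.Fin.Properties using (toℕ<n; toℕ-fromℕ; toℕ-inject₁)
open import Data.Vec.Functional using (Vector; init)
open import Data.List using ([]; _∷_; _++_; filter; length; applyUpTo; upTo)
open import Data.List.Properties
  using (filter-++; filter-all; filter-reject; length-++; length-applyUpTo; applyUpTo-∷ʳ; ++-identityʳ)
open import Data.List.Relation.Unary.All using (All; _∷_)
open import Data.List.Relation.Unary.All.Properties using (applyUpTo⁺₁)
open import Data.Product using (_,_)
open import Data.Sum using (inj₁; inj₂)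
import Data.Sum as Sum
open import Data.Empty using (⊥-elim)
open import Relation.Nullary using (yes; no)
open import Relation.Binary.Definitions using (tri<; tri≈; tri>)
open import Relation.Binary.PropositionalEquality
import Algebra.Properties.CommutativeSemiring.Binomial +-*-commutativeSemiring as Binomial
open import Algebra.Properties.Monoid.Sum +-0-monoid using (sum; sum-init-last)
import Algebra.Definitions.RawSemiring +-*-rawSemiring as Semiring

-- For i ≥ 1 one has u (i + 2t) − u i = 2 · 3 ^ i · (9 ^ t − 1) / 8, while u (i + k) − u i is odd for
-- odd k. Hence u₁, …, uₙ stay distinct modulo the least power of 2 that is ≥ n, so d = D_S(n) ≤ 2n − 2,
-- and d cannot divide 3 ^ j · (9 ^ t − 1) / 4 for any j, t ≥ 1 with j + 2t ≤ (d + 3) / 2 (a collision).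
-- Write d = 2 ^ e · 3 ^ f · q with gcd(q, 6) = 1. Fermat's little theorem and lifting the exponent give
-- a period t ≤ (q − 1) / 2 of 9 modulo q, even t ≤ q / 4 unless q is a prime power, and this yields a
-- collision unless d = 2 ^ e or d = p ^ m with p > 3 prime. In the latter case 9 has period
-- L = p ^ (m − 1) · (p − 1) / 2 modulo d, and any smaller period would produce a proper divisor of L,
-- hence one of size at most L / 2: again a collision. So ord₉(d) = L; lifting a period of 9 modulo p,
-- or p² ∣ 3 ^ (p − 1) − 1, to one modulo d below L gives ord₉(p) = (p − 1) / 2 and, for m ≥ 2,
-- 3 ^ (p − 1) ≢ 1 (mod p²).

prime≥2 : ∀ {p} → Prime p → 2 ≤ p
prime≥2 {suc (suc p)} _ = s≤s (s≤s z≤n)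

prime∤⇒coprime : ∀ {p n} → Prime p → ¬ p ∣ n → Coprime p n
prime∤⇒coprime pr p∤n (i∣p , i∣n) with prime⇒irreducible pr i∣p
... | inj₁ i≡1 = i≡1
... | inj₂ refl = ⊥-elim (p∤n i∣n)

coprime-^ˡ : ∀ {m n} → Coprime m n → ∀ e → Coprime (m ^ e) n
coprime-^ˡ c zero (i∣1 , _) = ∣1⇒≡1 i∣1
coprime-^ˡ {m} c (suc e) {i} (i∣m*mᵉ , i∣n) =
  coprime-^ˡ c e (coprime-divisor i⊥m i∣m*mᵉ , i∣n)
  where
  i⊥m : Coprime i m
  i⊥m (j∣i , j∣m) = c (j∣m , ∣-trans j∣i i∣n)

prime-power-cancel : ∀ {p y} → Prime p → ¬ p ∣ y → ∀ e {x} → p ^ e ∣ y * x → p ^ e ∣ x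
prime-power-cancel pr p∤y e = coprime-divisor (coprime-^ˡ (prime∤⇒coprime pr p∤y) e)

coprime-∣⇒*-∣ : ∀ {m n x} → Coprime m n → m ∣ x → n ∣ x → m * n ∣ x
coprime-∣⇒*-∣ {m} {n} m⊥n (divides k refl) n∣k*m =
  subst (m * n ∣_) (*-comm m k) (*-monoʳ-∣ m (coprime-divisor (Coprime.sym m⊥n) (subst (n ∣_) (*-comm k m) n∣k*m)))

odd⇒coprime-2^e : ∀ {m} → ¬ 2 ∣ m → ∀ e → Coprime (2 ^ e) m
odd⇒coprime-2^e 2∤m = coprime-^ˡ (prime∤⇒coprime prime[2] 2∤m)

prime∣p^e⇒∣p : ∀ {q p} → Prime q → ∀ e → q ∣ p ^ e → q ∣ p
prime∣p^e⇒∣p prime-q zero    q∣1 = ⊥-elim (<⇒≢ (prime≥2 prime-q) (sym (∣1⇒≡1 q∣1)))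
prime∣p^e⇒∣p {p = p} prime-q (suc e) q∣p^[1+e] with euclidsLemma p (p ^ e) prime-q q∣p^[1+e]
... | inj₁ q∣p   = q∣p
... | inj₂ q∣p^e = prime∣p^e⇒∣p prime-q e q∣p^e

prime∣prime⇒≡ : ∀ {p q} → Prime p → Prime q → p ∣ q → p ≡ q
prime∣prime⇒≡ prime-p prime-q p∣q with prime⇒irreducible prime-q p∣q
... | inj₁ p≡1 = ⊥-elim (<⇒≢ (prime≥2 prime-p) (sym p≡1))
... | inj₂ p≡q = p≡q

prime-factor : ∀ n → 2 ≤ n → ∃[ p ] Prime p × p ∣ n
prime-factor n@(suc _) 2≤n with factorise n
... | record { factors = [] ; isFactorisation = n≡1 } = ⊥-elim (<⇒≢ 2≤n (sym n≡1))
... | record { factors = p ∷ ps ; isFactorisation = n≡ ; factorsPrime = prime-p ∷ _ } =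
  p , prime-p , divides (product ps) (trans n≡ (*-comm p _))

coprime-6-prime⇒>3 : ∀ {p q} → Prime p → p ∣ q → ¬ 2 ∣ q → ¬ 3 ∣ q → 3 < p
coprime-6-prime⇒>3 {suc (suc zero)}                _ p∣q 2∤q _   = ⊥-elim (2∤q p∣q)
coprime-6-prime⇒>3 {suc (suc (suc zero))}          _ p∣q _   3∤q = ⊥-elim (3∤q p∣q)
coprime-6-prime⇒>3 {suc (suc (suc (suc _)))}       _ _   _   _   = s≤s (s≤s (s≤s (s≤s z≤n)))

2∤1+2k : ∀ k → ¬ 2 ∣ 1 + 2 * k
2∤1+2k k 2∣ = 2≢1 (∣1⇒≡1 (∣m+n∣m⇒∣n (subst (2 ∣_) (+-comm 1 (2 * k)) 2∣) (m∣m*n k)))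
  where
  2≢1 : 2 ≢ 1
  2≢1 ()

2∤3^i : ∀ i → ¬ 2 ∣ 3 ^ i
2∤3^i zero    2∣1 with ∣1⇒≡1 2∣1
... | ()
2∤3^i (suc i) 2∣3^[1+i] with euclidsLemma 3 (3 ^ i) prime[2] 2∣3^[1+i]
... | inj₁ 2∣3   = 2∤1+2k 1 2∣3
... | inj₂ 2∣3^i = 2∤3^i i 2∣3^i

odd⊎even : ∀ i → 1 ≤ i → (∃[ s ] i ≡ 1 + 2 * s) ⊎ (∃[ s ] i ≡ 2 + 2 * s)
odd⊎even (suc zero)    _ = inj₁ (0 , refl)
odd⊎even (suc (suc i)) _ with odd⊎even (suc i) (s≤s z≤n)
... | inj₁ (s , eq) = inj₂ (s , cong suc eq)
... | inj₂ (s , eq) = inj₁ (suc s , trans (cong suc eq) (regroup s))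
  where
  regroup : ∀ s → 3 + 2 * s ≡ 1 + 2 * suc s
  regroup = solve-∀

odd-prime : ∀ {p} → Prime p → p ≢ 2 → ∃[ r ] 1 ≤ r × p ≡ 1 + 2 * r
odd-prime prime-p p≢2 with odd⊎even _ (≤-trans (s≤s z≤n) (prime≥2 prime-p))
... | inj₁ (r , refl) = r , n≢0⇒n>0 (λ r≡0 → <⇒≱ (prime≥2 prime-p) (≤-reflexive (cong (λ x → 1 + 2 * x) r≡0))) , refl
... | inj₂ (s , refl) = ⊥-elim (p≢2 (sym (prime∣prime⇒≡ prime[2] prime-p 2∣2+2s)))
  where
  2∣2+2s : 2 ∣ 2 + 2 * s
  2∣2+2s = divides (1 + s) (trans (sym (*-distribˡ-+ 2 1 s)) (*-comm 2 (1 + s)))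

∣∧<⇒2*≤ : ∀ {g L} → g ∣ L → g < L → 2 * g ≤ L
∣∧<⇒2*≤ (divides zero          refl) ()
∣∧<⇒2*≤ {g} (divides (suc zero)    refl) g<L = ⊥-elim (<-irrefl (sym (*-identityˡ g)) g<L)
∣∧<⇒2*≤ {g} (divides (suc (suc c)) refl) _   = *-monoˡ-≤ g (s≤s (s≤s (z≤n {c})))

factor-out : ∀ p → 2 ≤ p → ∀ n → 1 ≤ n → ∃[ e ] ∃[ m ] n ≡ p ^ e * m × ¬ p ∣ m
factor-out p 2≤p = <-rec (λ n → 1 ≤ n → ∃[ e ] ∃[ m ] n ≡ p ^ e * m × ¬ p ∣ m) step
  where
  step : ∀ n → (∀ {n′} → n′ < n → 1 ≤ n′ → ∃[ e ] ∃[ m ] n′ ≡ p ^ e * m × ¬ p ∣ m) →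
         1 ≤ n → ∃[ e ] ∃[ m ] n ≡ p ^ e * m × ¬ p ∣ m
  step n rec 1≤n with p ∣? n
  ... | no  p∤n = 0 , n , sym (*-identityˡ n) , p∤n
  ... | yes (divides n′ refl) with rec (m<m*n n′ p ⦃ >-nonZero 1≤n′ ⦄ 2≤p) 1≤n′
    where
    1≤n′ : 1 ≤ n′
    1≤n′ = n≢0⇒n>0 (λ { refl → <⇒≱ 1≤n z≤n })
  ...   | e , m , refl , p∤m = suc e , m , regroup (p ^ e) m p , p∤m
    where
    regroup : ∀ x m p → x * m * p ≡ p * x * m
    regroup = solve-∀


-- Fermat's little theorem

[1+k]*[1+n]C[1+k] : ∀ n k → suc k * (suc n C suc k) ≡ suc n * (n C k)
[1+k]*[1+n]C[1+k] zero    zero    = refl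
[1+k]*[1+n]C[1+k] zero    (suc k) = *-zeroʳ (suc (suc k))
[1+k]*[1+n]C[1+k] (suc n) zero    = trans (+-identityʳ _) (trans (nC1≡n (suc (suc n))) (sym (*-identityʳ _)))
[1+k]*[1+n]C[1+k] (suc n) (suc k) = begin
  (2 + k) * ((2 + n) C (2 + k))
    ≡⟨ cong ((2 + k) *_) (nCk+nC[k+1]≡[n+1]C[k+1] (suc n) (suc k)) ⟨
  (2 + k) * ((1 + n) C (1 + k) + (1 + n) C (2 + k))
    ≡⟨ split ((1 + n) C (1 + k)) ((1 + n) C (2 + k)) k ⟩
  (1 + k) * ((1 + n) C (1 + k)) + ((1 + n) C (1 + k)) + (2 + k) * ((1 + n) C (2 + k))
    ≡⟨ cong₂ (λ a b → a + ((1 + n) C (1 + k)) + b) ([1+k]*[1+n]C[1+k] n k) ([1+k]*[1+n]C[1+k] n (suc k)) ⟩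
  (1 + n) * (n C k) + ((1 + n) C (1 + k)) + (1 + n) * (n C (1 + k))
    ≡⟨ cong (λ a → (1 + n) * (n C k) + a + (1 + n) * (n C (1 + k))) (nCk+nC[k+1]≡[n+1]C[k+1] n k) ⟨
  (1 + n) * (n C k) + (n C k + n C (1 + k)) + (1 + n) * (n C (1 + k))
    ≡⟨ merge (n C k) (n C (1 + k)) n ⟩
  (2 + n) * (n C k + n C (1 + k))
    ≡⟨ cong ((2 + n) *_) (nCk+nC[k+1]≡[n+1]C[k+1] n k) ⟩
  (2 + n) * ((1 + n) C (1 + k)) ∎
  where
  open ≡-Reasoning
  split : ∀ a b k → (2 + k) * (a + b) ≡ (1 + k) * a + a + (2 + k) * b
  split = solve-∀
  merge : ∀ a b n → (1 + n) * a + (a + b) + (1 + n) * b ≡ (2 + n) * (a + b)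
  merge = solve-∀

p∣pCk : ∀ {p k} → Prime p → 0 < k → k < p → p ∣ p C k
p∣pCk {suc p} {suc k} pr _ k<p with euclidsLemma (suc k) (suc p C suc k) pr
  (divides (p C k) (trans ([1+k]*[1+n]C[1+k] p k) (*-comm (suc p) _)))
... | inj₁ p∣1+k = ⊥-elim (<⇒≱ k<p (∣⇒≤ p∣1+k))
... | inj₂ p∣pCk = p∣pCk

^ₛ≡^ : ∀ x n → x Semiring.^ n ≡ x ^ n
^ₛ≡^ x zero    = refl
^ₛ≡^ x (suc n) = cong (x *_) (^ₛ≡^ x n)

×ₛ≡* : ∀ n x → n Semiring.× x ≡ n * x
×ₛ≡* zero    x = refl
×ₛ≡* (suc n) x = cong (_+_ x) (×ₛ≡* n x)

binomialTerm≡ : ∀ x n k → Binomial.binomialTerm x 1 n k ≡ (n C toℕ k) * x ^ toℕ k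
binomialTerm≡ x n k = begin
  (n C toℕ k) Semiring.× (x Semiring.^ toℕ k * 1 Semiring.^ (n ∸ toℕ k))
    ≡⟨ ×ₛ≡* (n C toℕ k) _ ⟩
  (n C toℕ k) * (x Semiring.^ toℕ k * 1 Semiring.^ (n ∸ toℕ k))
    ≡⟨ cong₂ (λ a b → (n C toℕ k) * (a * b)) (^ₛ≡^ x (toℕ k)) (trans (^ₛ≡^ 1 (n ∸ toℕ k)) (^-zeroˡ (n ∸ toℕ k))) ⟩
  (n C toℕ k) * (x ^ toℕ k * 1)
    ≡⟨ cong ((n C toℕ k) *_) (*-identityʳ (x ^ toℕ k)) ⟩
  (n C toℕ k) * x ^ toℕ k ∎
  where open ≡-Reasoning

sum-∣ : ∀ {d n} (f : Vector ℕ n) → (∀ i → d ∣ f i) → d ∣ sum f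
sum-∣ {n = zero}  f d∣f = divides 0 refl
sum-∣ {n = suc n} f d∣f = ∣m∣n⇒∣m+n (d∣f Fin.zero) (sum-∣ (λ i → f (Fin.suc i)) (λ i → d∣f (Fin.suc i)))

freshman : ∀ {p} → Prime p → ∀ x → ∃[ c ] (x + 1) ^ p ≡ x ^ p + 1 + c * p
freshman {suc m} pr x with sum-∣ (init (λ i → term (Fin.suc i))) middle
  where
  term = Binomial.binomialTerm x 1 (suc m)
  middle : ∀ i → suc m ∣ term (Fin.suc (inject₁ i))
  middle i rewrite binomialTerm≡ x (suc m) (Fin.suc (inject₁ i)) | toℕ-inject₁ i =
    ∣m⇒∣m*n _ (p∣pCk pr (s≤s z≤n) (s≤s (toℕ<n i)))
... | divides c middle≡ = c , (begin
  (x + 1) ^ suc m ≡⟨ ^ₛ≡^ (x + 1) (suc m) ⟨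
  (x + 1) Semiring.^ suc m ≡⟨ Binomial.theorem (suc m) x 1 ⟩
  term Fin.zero + sum (λ i → term (Fin.suc i)) ≡⟨ cong (_+_ (term Fin.zero)) (sum-init-last (λ i → term (Fin.suc i))) ⟩
  term Fin.zero + (sum (init (λ i → term (Fin.suc i))) + term (Fin.suc (fromℕ m))) ≡⟨ cong₂ (λ a b → a + (b + term (Fin.suc (fromℕ m)))) first middle≡ ⟩
  1 + (c * suc m + term (Fin.suc (fromℕ m))) ≡⟨ cong (λ a → 1 + (c * suc m + a)) lastTerm ⟩
  1 + (c * suc m + x ^ suc m) ≡⟨ shuffle 1 (c * suc m) (x ^ suc m) ⟩
  x ^ suc m + 1 + c * suc m ∎)
  where
  open ≡-Reasoning
  term = Binomial.binomialTerm x 1 (suc m)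
  first : term Fin.zero ≡ 1
  first = trans (binomialTerm≡ x (suc m) Fin.zero) refl
  lastTerm : term (Fin.suc (fromℕ m)) ≡ x ^ suc m
  lastTerm rewrite binomialTerm≡ x (suc m) (Fin.suc (fromℕ m)) | toℕ-fromℕ m | nCn≡1 (suc m) = +-identityʳ _
  shuffle : ∀ a b c → a + (b + c) ≡ c + a + b
  shuffle = solve-∀

fermat : ∀ {p} → Prime p → ∀ x → ∃[ c ] x ^ p ≡ x + c * p
fermat {suc m} pr zero    = 0 , refl
fermat {p}     pr (suc x) with fermat pr x | freshman pr x
... | c , x^p≡ | c′ , [x+1]^p≡ = c + c′ , (begin
  suc x ^ p             ≡⟨ cong (_^ p) (+-comm 1 x) ⟩
  (x + 1) ^ p           ≡⟨ [x+1]^p≡ ⟩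
  x ^ p + 1 + c′ * p    ≡⟨ cong (λ y → y + 1 + c′ * p) x^p≡ ⟩
  x + c * p + 1 + c′ * p ≡⟨ regroup x c c′ p ⟩
  suc x + (c + c′) * p  ∎)
  where
  open ≡-Reasoning
  regroup : ∀ x c c′ p → x + c * p + 1 + c′ * p ≡ suc x + (c + c′) * p
  regroup = solve-∀


-- The sums geom t = 1 + 9 + ⋯ + 9 ^ (t ∸ 1)

geom : ℕ → ℕ
geom zero    = 0
geom (suc t) = 1 + 9 * geom t

9^t≡1+8*geom[t] : ∀ t → 9 ^ t ≡ 1 + 8 * geom t
9^t≡1+8*geom[t] zero    = refl
9^t≡1+8*geom[t] (suc t) = trans (cong (9 *_) (9^t≡1+8*geom[t] t)) (regroup (geom t))
  where
  regroup : ∀ g → 9 * (1 + 8 * g) ≡ 1 + 8 * (1 + 9 * g)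
  regroup = solve-∀

geom-+ : ∀ a b → geom (a + b) ≡ geom a + 9 ^ a * geom b
geom-+ zero    b = sym (+-identityʳ (geom b))
geom-+ (suc a) b = trans (cong (λ g → 1 + 9 * g) (geom-+ a b)) (regroup (geom a) (9 ^ a) (geom b))
  where
  regroup : ∀ x y z → 1 + 9 * (x + y * z) ≡ 1 + 9 * x + 9 * y * z
  regroup = solve-∀

geom-*-∣ : ∀ a c → geom a ∣ geom (c * a)
geom-*-∣ a zero    = divides 0 refl
geom-*-∣ a (suc c) = subst (geom a ∣_) (sym (geom-+ a (c * a)))
  (∣m∣n⇒∣m+n ∣-refl (∣n⇒∣m*n (9 ^ a) (geom-*-∣ a c)))

geom-∣ : ∀ {a b} → a ∣ b → geom a ∣ geom b
geom-∣ {a} (divides c refl) = geom-*-∣ a c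

geom[2t] : ∀ t → geom (2 * t) ≡ 2 * (geom t * (1 + 4 * geom t))
geom[2t] t = begin
  geom (2 * t)                     ≡⟨ cong geom (cong (_+_ t) (+-identityʳ t)) ⟩
  geom (t + t)                     ≡⟨ geom-+ t t ⟩
  geom t + 9 ^ t * geom t          ≡⟨ cong (λ x → geom t + x * geom t) (9^t≡1+8*geom[t] t) ⟩
  geom t + (1 + 8 * geom t) * geom t ≡⟨ regroup (geom t) ⟩
  2 * (geom t * (1 + 4 * geom t))  ∎
  where
  open ≡-Reasoning
  regroup : ∀ g → g + (1 + 8 * g) * g ≡ 2 * (g * (1 + 4 * g))
  regroup = solve-∀


2∣geom[t]+t : ∀ t → 2 ∣ geom t + t
2∣geom[t]+t zero    = divides 0 refl
2∣geom[t]+t (suc t) = subst (2 ∣_) (regroup (geom t) t)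
  (∣m∣n⇒∣m+n (divides (1 + 4 * geom t) (even (geom t))) (2∣geom[t]+t t))
  where
  regroup : ∀ g t → 2 + 8 * g + (g + t) ≡ 1 + 9 * g + suc t
  regroup = solve-∀
  even : ∀ g → 2 + 8 * g ≡ (1 + 4 * g) * 2
  even = solve-∀

2^e∣geom[t]⇒2^e∣t : ∀ e t → 2 ^ e ∣ geom t → 2 ^ e ∣ t
2^e∣geom[t]⇒2^e∣t zero    t _ = 1∣ t
2^e∣geom[t]⇒2^e∣t (suc e) t 2^[1+e]∣geom[t]
  with ∣m+n∣m⇒∣n (2∣geom[t]+t t) (∣-trans (m∣m*n (2 ^ e)) 2^[1+e]∣geom[t])
... | divides s refl =
  subst (2 * 2 ^ e ∣_) (*-comm 2 s) (*-monoʳ-∣ 2 (2^e∣geom[t]⇒2^e∣t e s 2^e∣geom[s]))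
  where
  odd : ¬ 2 ∣ 1 + 4 * geom s
  odd = subst (λ x → ¬ 2 ∣ 1 + x) (sym (*-assoc 2 2 (geom s))) (2∤1+2k (2 * geom s))
  2^e∣odd*geom[s] : 2 ^ e ∣ (1 + 4 * geom s) * geom s
  2^e∣odd*geom[s] = *-cancelˡ-∣ 2 (subst (2 * 2 ^ e ∣_)
    (trans (cong geom (*-comm s 2)) (trans (geom[2t] s) (cong (2 *_) (*-comm (geom s) _))))
    2^[1+e]∣geom[t])
  2^e∣geom[s] : 2 ^ e ∣ geom s
  2^e∣geom[s] = prime-power-cancel prime[2] odd e 2^e∣odd*geom[s]

2^e∣geom[2^e] : ∀ e → 2 ^ e ∣ geom (2 ^ e)
2^e∣geom[2^e] zero    = ∣-refl
2^e∣geom[2^e] (suc e) = subst (2 * 2 ^ e ∣_) (sym (geom[2t] (2 ^ e)))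
  (*-monoʳ-∣ 2 (∣m⇒∣m*n _ (2^e∣geom[2^e] e)))


-- Since 8 * geom t = 9 ^ t ∸ 1, N ∣ 8 * geom t says that t is a period of 9 modulo N.
∣8geom-∣ : ∀ {N a b} → N ∣ 8 * geom a → a ∣ b → N ∣ 8 * geom b
∣8geom-∣ N∣ a∣b = ∣-trans N∣ (*-monoʳ-∣ 8 (geom-∣ a∣b))

∣8geom[g+k]⇒∣8geom[g] : ∀ {N} g k → N ∣ 8 * geom k → N ∣ 8 * geom (g + k) → N ∣ 8 * geom g
∣8geom[g+k]⇒∣8geom[g] {N} g k N∣k N∣g+k = ∣m+n∣m⇒∣n (subst (N ∣_) split N∣g+k) (∣n⇒∣m*n (9 ^ g) N∣k)
  where
  split : 8 * geom (g + k) ≡ 9 ^ g * (8 * geom k) + 8 * geom g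
  split = trans (cong (8 *_) (geom-+ g k)) (regroup (geom g) (9 ^ g) (geom k))
    where
    regroup : ∀ x y z → 8 * (x + y * z) ≡ y * (8 * z) + 8 * x
    regroup = solve-∀

∣8geom-gcd : ∀ {N a b} → N ∣ 8 * geom a → N ∣ 8 * geom b → N ∣ 8 * geom (gcd a b)
∣8geom-gcd {N} {a} {b} N∣a N∣b with Bézout.identity (gcd-GCD a b)
... | Bézout.+- x y eq = ∣8geom[g+k]⇒∣8geom[g] (gcd a b) (y * b) (∣8geom-∣ N∣b (n∣m*n y))
                           (subst (λ k → N ∣ 8 * geom k) (sym eq) (∣8geom-∣ N∣a (n∣m*n x)))
... | Bézout.-+ x y eq = ∣8geom[g+k]⇒∣8geom[g] (gcd a b) (x * a) (∣8geom-∣ N∣a (n∣m*n x))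
                           (subst (λ k → N ∣ 8 * geom k) (sym eq) (∣8geom-∣ N∣b (n∣m*n y)))

[1+x]^k≡1+kx+O[x²] : ∀ x k → ∃[ c ] (1 + x) ^ k ≡ 1 + k * x + c * (x * x)
[1+x]^k≡1+kx+O[x²] x zero    = 0 , refl
[1+x]^k≡1+kx+O[x²] x (suc k) with [1+x]^k≡1+kx+O[x²] x k
... | c , eq = c + k + c * x , trans (cong ((1 + x) *_) eq) (regroup x k c)
  where
  regroup : ∀ x k c → (1 + x) * (1 + k * x + c * (x * x)) ≡ 1 + suc k * x + (c + k + c * x) * (x * x)
  regroup = solve-∀

∣8geom-lift : ∀ {p N t} → p ∣ N → N ∣ 8 * geom t → p * N ∣ 8 * geom (p * t)
∣8geom-lift {p} {N} {t} p∣N N∣x with [1+x]^k≡1+kx+O[x²] (8 * geom t) p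
... | c , eq = subst (p * N ∣_) (sym expand)
  (∣m∣n⇒∣m+n (*-monoʳ-∣ p N∣x) (∣n⇒∣m*n c (*-pres-∣ (∣-trans p∣N N∣x) N∣x)))
  where
  x = 8 * geom t
  expand : 8 * geom (p * t) ≡ p * x + c * (x * x)
  expand = suc-injective (begin
    1 + 8 * geom (p * t) ≡⟨ 9^t≡1+8*geom[t] (p * t) ⟨
    9 ^ (p * t)          ≡⟨ cong (9 ^_) (*-comm p t) ⟩
    9 ^ (t * p)          ≡⟨ ^-*-assoc 9 t p ⟨
    (9 ^ t) ^ p          ≡⟨ cong (_^ p) (9^t≡1+8*geom[t] t) ⟩
    (1 + x) ^ p          ≡⟨ eq ⟩
    1 + p * x + c * (x * x) ∎)
    where open ≡-Reasoning

∣8geom-lift^ : ∀ {p N t} → p ∣ N → N ∣ 8 * geom t → ∀ i → p ^ i * N ∣ 8 * geom (p ^ i * t)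
∣8geom-lift^ {p} {N} {t} p∣N N∣x zero = subst₂ (λ a b → a ∣ 8 * geom b)
  (sym (*-identityˡ N)) (sym (*-identityˡ t)) N∣x
∣8geom-lift^ {p} {N} {t} p∣N N∣x (suc i) = subst₂ (λ a b → a ∣ 8 * geom b)
  (sym (*-assoc p (p ^ i) N)) (sym (*-assoc p (p ^ i) t))
  (∣8geom-lift (∣n⇒∣m*n (p ^ i) p∣N) (∣8geom-lift^ p∣N N∣x i))

odd⇒∣8geom⇒∣geom : ∀ {q T} → ¬ 2 ∣ q → q ∣ 8 * geom T → q ∣ geom T
odd⇒∣8geom⇒∣geom 2∤q = coprime-divisor (Coprime.sym (odd⇒coprime-2^e 2∤q 3))

fermat₉ : ∀ {p r} → Prime p → p ≡ 1 + 2 * r → ¬ p ∣ 3 → p ∣ 8 * geom r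
fermat₉ {p} {r} prime-p p≡1+2r p∤3 with fermat prime-p 3
... | c , 3^p≡3+cp with euclidsLemma 3 (8 * geom r) prime-p (divides c 3*8geom≡cp)
  where
  3*8geom≡cp : 3 * (8 * geom r) ≡ c * p
  3*8geom≡cp = +-cancelˡ-≡ 3 _ _ (begin
    3 + 3 * (8 * geom r) ≡⟨ expand (geom r) ⟩
    3 * (1 + 8 * geom r) ≡⟨ cong (3 *_) (trans (sym (9^t≡1+8*geom[t] r)) (^-*-assoc 3 2 r)) ⟩
    3 ^ (1 + 2 * r)      ≡⟨ cong (3 ^_) p≡1+2r ⟨
    3 ^ p                ≡⟨ 3^p≡3+cp ⟩
    3 + c * p            ∎)
    where
    open ≡-Reasoning
    expand : ∀ g → 3 + 3 * (8 * g) ≡ 3 * (1 + 8 * g)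
    expand = solve-∀
... | inj₁ p∣3 = ⊥-elim (p∤3 p∣3)
... | inj₂ p∣8geom = p∣8geom

-- gcd j L is again a period, and as a proper divisor of L it is at most L / 2.
minimal-period : ∀ {d L} → (∀ t → 1 ≤ t → 4 * t ≤ d + 1 → ¬ d ∣ 8 * geom t) →
             d ∣ 8 * geom L → 2 * L ≤ d + 1 → ∀ j → 1 ≤ j → j < L → ¬ d ∣ 8 * geom j
minimal-period {d} {L} no-short d∣L 2L≤d+1 j 1≤j j<L d∣j = no-short g 1≤g 4g≤d+1 (∣8geom-gcd {a = j} {b = L} d∣j d∣L)
  where
  g = gcd j L
  1≤g : 1 ≤ g
  1≤g = n≢0⇒n>0 (gcd[m,n]≢0 j L (inj₁ (≢-sym (<⇒≢ 1≤j))))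
  4g≤d+1 : 4 * g ≤ d + 1
  4g≤d+1 = begin
    4 * g       ≡⟨ *-assoc 2 2 g ⟩
    2 * (2 * g) ≤⟨ *-monoʳ-≤ 2 (∣∧<⇒2*≤ (gcd[m,n]∣n j L) (≤-<-trans (∣⇒≤ ⦃ >-nonZero 1≤j ⦄ (gcd[m,n]∣m j L)) j<L)) ⟩
    2 * L       ≤⟨ 2L≤d+1 ⟩
    d + 1       ∎
    where open ≤-Reasoning

PrimePower : ℕ → Set
PrimePower q = ∃[ p ] ∃[ m ] Prime p × 1 ≤ m × q ≡ p ^ m

-- Carmichael-type bound: 9 has a period modulo q of size at most (q − 1) / 2, and at most q / 4
-- unless q is a prime power.
ShortPeriod : ℕ → Set
ShortPeriod q = ∃[ t ] 1 ≤ t × q ∣ 8 * geom t × 1 + 2 * t ≤ q × (PrimePower q ⊎ 4 * t ≤ q)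

short-period-* : ∀ {p r q} → Prime p → p ≡ 1 + 2 * r → 1 ≤ r → ¬ p ∣ 3 → ShortPeriod q → ShortPeriod (q * p)
short-period-* {p} {r} {q} prime-p p≡1+2r 1≤r p∤3 (t , 1≤t , q∣ , 1+2t≤q , pp⊎4t≤q) with p ∣? q
... | yes p∣q = p * t , *-mono-≤ 1≤p 1≤t , subst (_∣ 8 * geom (p * t)) (*-comm p q) (∣8geom-lift p∣q q∣)
              , 1+2pt≤q*p , Sum.map primePower 4pt≤q*p pp⊎4t≤q
  where
  1≤p = ≤-trans (s≤s z≤n) (prime≥2 prime-p)
  4pt≤q*p : 4 * t ≤ q → 4 * (p * t) ≤ q * p
  4pt≤q*p 4t≤q = begin
    4 * (p * t) ≡⟨ swap 4 p t ⟩
    p * (4 * t) ≤⟨ *-monoʳ-≤ p 4t≤q ⟩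
    p * q       ≡⟨ *-comm p q ⟩
    q * p       ∎
    where
    open ≤-Reasoning
    swap : ∀ x y z → x * (y * z) ≡ y * (x * z)
    swap = solve-∀
  1+2pt≤q*p : 1 + 2 * (p * t) ≤ q * p
  1+2pt≤q*p = begin
    1 + 2 * (p * t) ≤⟨ +-monoˡ-≤ (2 * (p * t)) 1≤p ⟩
    p + 2 * (p * t) ≡⟨ factor p t ⟩
    (1 + 2 * t) * p ≤⟨ *-monoˡ-≤ p 1+2t≤q ⟩
    q * p ∎
    where
    open ≤-Reasoning
    factor : ∀ p t → p + 2 * (p * t) ≡ (1 + 2 * t) * p
    factor = solve-∀
  primePower : PrimePower q → PrimePower (q * p)
  primePower (p′ , m , prime-p′ , 1≤m , q≡p′^m) with prime∣prime⇒≡ prime-p prime-p′ (prime∣p^e⇒∣p prime-p m (subst (p ∣_) q≡p′^m p∣q))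
  ... | refl = p , suc m , prime-p , s≤s z≤n , trans (cong (_* p) q≡p′^m) (*-comm (p ^ m) p)
... | no p∤q = r * t , 1≤rt , q*p∣ , ≤-trans 1+2rt≤4rt 4rt≤q*p , inj₂ 4rt≤q*p
  where
  1≤rt = *-mono-≤ 1≤r 1≤t
  q*p∣ : q * p ∣ 8 * geom (r * t)
  q*p∣ = coprime-∣⇒*-∣ (Coprime.sym (prime∤⇒coprime prime-p p∤q))
    (∣8geom-∣ q∣ (n∣m*n r)) (∣8geom-∣ {a = r} (fermat₉ {r = r} prime-p p≡1+2r p∤3) (m∣m*n t))
  4rt≤q*p : 4 * (r * t) ≤ q * p
  4rt≤q*p = begin
    4 * (r * t)       ≡⟨ regroup r t ⟩
    (2 * t) * (2 * r) ≤⟨ *-mono-≤ (≤-trans (n≤1+n _) 1+2t≤q) (≤-trans (n≤1+n _) (≤-reflexive (sym p≡1+2r))) ⟩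
    q * p             ∎
    where
    open ≤-Reasoning
    regroup : ∀ r t → 4 * (r * t) ≡ (2 * t) * (2 * r)
    regroup = solve-∀
  1+2rt≤4rt : 1 + 2 * (r * t) ≤ 4 * (r * t)
  1+2rt≤4rt = subst (1 + 2 * (r * t) ≤_) (double (r * t)) (+-monoˡ-≤ (2 * (r * t)) (≤-trans 1≤rt (m≤m+n (r * t) _)))
    where
    double : ∀ x → 2 * x + 2 * x ≡ 4 * x
    double = solve-∀

short-period : ∀ q → 2 ≤ q → ¬ 2 ∣ q → ¬ 3 ∣ q → ShortPeriod q
short-period = <-rec (λ q → 2 ≤ q → ¬ 2 ∣ q → ¬ 3 ∣ q → ShortPeriod q) step
  where
  step : ∀ q → (∀ {q′} → q′ < q → 2 ≤ q′ → ¬ 2 ∣ q′ → ¬ 3 ∣ q′ → ShortPeriod q′) →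
         2 ≤ q → ¬ 2 ∣ q → ¬ 3 ∣ q → ShortPeriod q
  step q rec 2≤q 2∤q 3∤q with prime-factor q 2≤q
  ... | p , prime-p , p∣q@(divides q′ q≡q′*p) with odd-prime prime-p (λ { refl → 2∤q p∣q })
  ...   | r , 1≤r , refl = subst ShortPeriod (sym q≡q′*p) (cofactor q′ q≡q′*p)
    where
    p∤3 : ¬ p ∣ 3
    p∤3 p∣3 = 3∤q (subst (_∣ q) (≤-antisym (∣⇒≤ p∣3) (s≤s (*-monoʳ-≤ 2 1≤r))) p∣q)
    cofactor : ∀ q′ → q ≡ q′ * p → ShortPeriod (q′ * p)
    cofactor zero          q≡0   = ⊥-elim (<⇒≱ 2≤q (≤-trans (≤-reflexive q≡0) z≤n))
    cofactor (suc zero)    _     = r , 1≤r , subst (_∣ 8 * geom r) (sym (*-identityˡ p)) (fermat₉ {r = r} prime-p refl p∤3)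
                                 , ≤-reflexive (sym (*-identityˡ p))
                                 , inj₁ (p , 1 , prime-p , s≤s z≤n , trans (*-identityˡ p) (sym (*-identityʳ p)))
    cofactor q′@(suc (suc _)) q≡q′*p = short-period-* prime-p refl 1≤r p∤3
      (rec q′<q (s≤s (s≤s z≤n)) (λ 2∣q′ → 2∤q (∣-trans 2∣q′ q′∣q)) (λ 3∣q′ → 3∤q (∣-trans 3∣q′ q′∣q)))
      where
      q′∣q : q′ ∣ q
      q′∣q = divides p (trans q≡q′*p (*-comm q′ p))
      q′<q : q′ < q
      q′<q = subst (q′ <_) (sym q≡q′*p) (m<m*n q′ p (prime≥2 prime-p))

half-period : ∀ q → 1 ≤ q → ¬ 2 ∣ q → ¬ 3 ∣ q → ∃[ T ] 1 ≤ T × q ∣ geom T × 2 * T ≤ q + 1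
half-period (suc zero)      _ _   _   = 1 , ≤-refl , ∣-refl , ≤-refl
half-period q@(suc (suc _)) _ 2∤q 3∤q with short-period q (s≤s (s≤s z≤n)) 2∤q 3∤q
... | T , 1≤T , q∣ , 1+2T≤q , _ = T , 1≤T , odd⇒∣8geom⇒∣geom {T = T} 2∤q q∣ , ≤-trans (n≤1+n _) (≤-trans 1+2T≤q (m≤m+n q 1))


-- Euler's totient of a prime power

applyUpTo-+ : ∀ {A : Set} (f : ℕ → A) m n → applyUpTo f (m + n) ≡ applyUpTo f m ++ applyUpTo (λ k → f (m + k)) n
applyUpTo-+ f zero    n = refl
applyUpTo-+ f (suc m) n = cong (f 0 ∷_) (applyUpTo-+ (λ k → f (suc k)) m n)

coprime-count-block : ∀ {p} → Prime p → ∀ a c →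
        length (filter (λ k → coprime? (suc k) (p ^ suc a)) (applyUpTo (_+_ (c * p)) p)) ≡ p ∸ 1
coprime-count-block {suc p′} prime-p a c = begin
  length (filter P? (applyUpTo f (suc p′)))
    ≡⟨ cong (λ xs → length (filter P? xs)) (applyUpTo-∷ʳ f p′) ⟨
  length (filter P? (applyUpTo f p′ ++ f p′ ∷ []))
    ≡⟨ cong length (filter-++ P? (applyUpTo f p′) _) ⟩
  length (filter P? (applyUpTo f p′) ++ filter P? (f p′ ∷ []))
    ≡⟨ cong₂ (λ xs ys → length (xs ++ ys)) (filter-all P? coprime-init) (filter-reject P? ¬coprime-last) ⟩
  length (applyUpTo f p′ ++ [])
    ≡⟨ cong length (++-identityʳ (applyUpTo f p′)) ⟩
  length (applyUpTo f p′)
    ≡⟨ length-applyUpTo f p′ ⟩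
  p′ ∎
  where
  open ≡-Reasoning
  p = suc p′
  f = _+_ (c * p)
  P? = λ k → coprime? (suc k) (p ^ suc a)
  coprime-init : All (λ k → Coprime (suc k) (p ^ suc a)) (applyUpTo f p′)
  coprime-init = applyUpTo⁺₁ f p′ λ {i} i<p′ → Coprime.sym (coprime-^ˡ (prime∤⇒coprime prime-p (λ p∣ →
    <⇒≱ (s≤s i<p′) (∣⇒≤ (∣m+n∣m⇒∣n (subst (p ∣_) (sym (+-suc (c * p) i)) p∣) (n∣m*n c))))) (suc a))
  ¬coprime-last : ¬ Coprime (suc (f p′)) (p ^ suc a)
  ¬coprime-last coprime = <⇒≢ (prime≥2 prime-p) (sym (coprime (p∣1+f[p′] , m∣m*n (p ^ a))))
    where
    p∣1+f[p′] : p ∣ suc (c * p + p′)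
    p∣1+f[p′] = divides (suc c) (trans (sym (+-suc (c * p) p′)) (+-comm (c * p) p))

φ[p^[1+a]] : ∀ {p} → Prime p → ∀ a → φ (p ^ suc a) ≡ p ^ a * (p ∸ 1)
φ[p^[1+a]] {p} prime-p a = trans (cong (λ n → length (filter P? (upTo n))) (*-comm p (p ^ a))) (blocks (p ^ a))
  where
  P? = λ k → coprime? (suc k) (p ^ suc a)
  blocks : ∀ c → length (filter P? (upTo (c * p))) ≡ c * (p ∸ 1)
  blocks zero    = refl
  blocks (suc c) = begin
    length (filter P? (upTo (p + c * p)))
      ≡⟨ cong (λ n → length (filter P? (upTo n))) (+-comm p (c * p)) ⟩
    length (filter P? (upTo (c * p + p)))
      ≡⟨ cong (λ xs → length (filter P? xs)) (applyUpTo-+ (λ k → k) (c * p) p) ⟩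
    length (filter P? (upTo (c * p) ++ applyUpTo (_+_ (c * p)) p))
      ≡⟨ cong length (filter-++ P? (upTo (c * p)) _) ⟩
    length (filter P? (upTo (c * p)) ++ filter P? (applyUpTo (_+_ (c * p)) p))
      ≡⟨ length-++ (filter P? (upTo (c * p))) ⟩
    length (filter P? (upTo (c * p))) + length (filter P? (applyUpTo (_+_ (c * p)) p))
      ≡⟨ cong₂ _+_ (blocks c) (coprime-count-block prime-p a c) ⟩
    c * (p ∸ 1) + (p ∸ 1)
      ≡⟨ +-comm (c * (p ∸ 1)) (p ∸ 1) ⟩
    suc c * (p ∸ 1) ∎
    where open ≡-Reasoning


-- The Salajan sequence

pos-^ : ∀ m k → (+ m) ℤ.^ k ≡ + (m ^ k)
pos-^ m zero    = refl
pos-^ m (suc k) = trans (cong ((+ m) ℤ.*_) (pos-^ m k)) (sym (ℤ.pos-* m (m ^ k)))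

[-1]^[2s] : ∀ s → (- + 1) ℤ.^ (2 * s) ≡ + 1
[-1]^[2s] s = trans (sym (ℤ.^-*-assoc (- + 1) 2 s)) (ℤ.^-zeroˡ s)

+3^[2s] : ∀ s → (+ 3) ℤ.^ (2 * s) ≡ + 1 ℤ.+ + 8 ℤ.* + geom s
+3^[2s] s = begin
  (+ 3) ℤ.^ (2 * s)      ≡⟨ pos-^ 3 (2 * s) ⟩
  + (3 ^ (2 * s))        ≡⟨ cong +_ (trans (sym (^-*-assoc 3 2 s)) (9^t≡1+8*geom[t] s)) ⟩
  + (1 + 8 * geom s)   ≡⟨ ℤ.pos-+ 1 (8 * geom s) ⟩
  + 1 ℤ.+ + (8 * geom s) ≡⟨ cong (ℤ._+_ (+ 1)) (ℤ.pos-* 8 (geom s)) ⟩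
  + 1 ℤ.+ + 8 ℤ.* + geom s ∎
  where open ≡-Reasoning

/4-exact : ∀ {z} n → z ≡ + n ℤ.* + 4 → z ℤ./ + 4 ≡ + n
/4-exact {z} n refl = trans (cong (ℤ._/ + 4) (sym (ℤ.pos-* n 4)))
  (trans (ℤ.*-identityˡ _) (cong +_ (m*n/n≡m n 4)))

pos-+-* : ∀ a b g → + (a + b * g) ≡ + a ℤ.+ + b ℤ.* + g
pos-+-* a b g = trans (ℤ.pos-+ a (b * g)) (cong (ℤ._+_ (+ a)) (ℤ.pos-* b g))

u[1+2s] : ∀ s → u (1 + 2 * s) ≡ + (2 + 6 * geom s)
u[1+2s] s = /4-exact _ (begin
  + 3 ℤ.* (+ 3) ℤ.^ (2 * s) ℤ.- + 5 ℤ.* (- + 1 ℤ.* (- + 1) ℤ.^ (2 * s))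
    ≡⟨ cong₂ (λ a b → + 3 ℤ.* a ℤ.- + 5 ℤ.* (- + 1 ℤ.* b)) (+3^[2s] s) ([-1]^[2s] s) ⟩
  + 3 ℤ.* (+ 1 ℤ.+ + 8 ℤ.* + geom s) ℤ.- + 5 ℤ.* (- + 1 ℤ.* + 1)
    ≡⟨ eval (+ geom s) ⟩
  (+ 2 ℤ.+ + 6 ℤ.* + geom s) ℤ.* + 4
    ≡⟨ cong (ℤ._* + 4) (pos-+-* 2 6 (geom s)) ⟨
  + (2 + 6 * geom s) ℤ.* + 4 ∎)
  where
  open ≡-Reasoning
  eval : ∀ g → + 3 ℤ.* (+ 1 ℤ.+ + 8 ℤ.* g) ℤ.- + 5 ℤ.* (- + 1 ℤ.* + 1) ≡ (+ 2 ℤ.+ + 6 ℤ.* g) ℤ.* + 4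
  eval = ℤ-Solver.solve-∀

u[2+2s] : ∀ s → u (2 + 2 * s) ≡ + (1 + 18 * geom s)
u[2+2s] s = /4-exact _ (begin
  + 3 ℤ.* (+ 3 ℤ.* (+ 3) ℤ.^ (2 * s)) ℤ.- + 5 ℤ.* (- + 1 ℤ.* (- + 1 ℤ.* (- + 1) ℤ.^ (2 * s)))
    ≡⟨ cong₂ (λ a b → + 3 ℤ.* (+ 3 ℤ.* a) ℤ.- + 5 ℤ.* (- + 1 ℤ.* (- + 1 ℤ.* b))) (+3^[2s] s) ([-1]^[2s] s) ⟩
  + 3 ℤ.* (+ 3 ℤ.* (+ 1 ℤ.+ + 8 ℤ.* + geom s)) ℤ.- + 5 ℤ.* (- + 1 ℤ.* (- + 1 ℤ.* + 1))
    ≡⟨ eval (+ geom s) ⟩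
  (+ 1 ℤ.+ + 18 ℤ.* + geom s) ℤ.* + 4
    ≡⟨ cong (ℤ._* + 4) (pos-+-* 1 18 (geom s)) ⟨
  + (1 + 18 * geom s) ℤ.* + 4 ∎)
  where
  open ≡-Reasoning
  eval : ∀ g → + 3 ℤ.* (+ 3 ℤ.* (+ 1 ℤ.+ + 8 ℤ.* g)) ℤ.- + 5 ℤ.* (- + 1 ℤ.* (- + 1 ℤ.* + 1))
             ≡ (+ 1 ℤ.+ + 18 ℤ.* g) ℤ.* + 4
  eval = ℤ-Solver.solve-∀

∣+[a+d]-+a∣ : ∀ a d → ℤ.∣ + (a + d) ℤ.- + a ∣ ≡ d
∣+[a+d]-+a∣ a d = cong ℤ.∣_∣ (trans (cong (ℤ._- + a) (ℤ.pos-+ a d)) (cancel (+ a) (+ d)))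
  where
  cancel : ∀ x y → x ℤ.+ y ℤ.- x ≡ y
  cancel = ℤ-Solver.solve-∀

∣+a-+b∣-odd : ∀ {a b} → 2 ∣ a → ¬ 2 ∣ b → ¬ 2 ∣ ℤ.∣ + a ℤ.- + b ∣
∣+a-+b∣-odd {a} {b} 2∣a 2∤b 2∣∣a-b∣ with ≤-total a b
... | inj₁ a≤b = 2∤b (∣m∸n∣n⇒∣m 2 a≤b
  (subst (2 ∣_) (trans (cong ℤ.∣_∣ (ℤ.m-n≡m⊖n a b)) (ℤ.∣⊖∣-≤ a≤b)) 2∣∣a-b∣) 2∣a)
... | inj₂ b≤a = 2∤b (∣m+n∣m⇒∣n (subst (2 ∣_) (sym (m∸n+n≡m b≤a)) 2∣a)
  (subst (2 ∣_) (trans (cong ℤ.∣_∣ (ℤ.m-n≡m⊖n a b)) (trans (ℤ.∣m⊖n∣≡∣n⊖m∣ a b) (ℤ.∣⊖∣-≤ b≤a))) 2∣∣a-b∣))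

∣u[j]-u[i]∣ : ∀ i j {a d} → u i ≡ + a → u j ≡ + (a + d) → ℤ.∣ u j ℤ.- u i ∣ ≡ d
∣u[j]-u[i]∣ i j {a} {d} uᵢ uⱼ = trans (cong₂ (λ x y → ℤ.∣ x ℤ.- y ∣) uⱼ uᵢ) (∣+[a+d]-+a∣ a d)

3^[k+2s] : ∀ k s → 3 ^ (k + 2 * s) ≡ 3 ^ k * 9 ^ s
3^[k+2s] k s = trans (^-distribˡ-+-* 3 k (2 * s)) (cong (3 ^ k *_) (sym (^-*-assoc 3 2 s)))

c+2m*geom[s+t] : ∀ c m s t → c + 2 * m * geom (s + t) ≡ c + 2 * m * geom s + m * 9 ^ s * (2 * geom t)
c+2m*geom[s+t] c m s t = trans (cong (λ g → c + 2 * m * g) (geom-+ s t)) (ring c m (geom s) (9 ^ s) (geom t))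
  where
  ring : ∀ c m a b g → c + 2 * m * (a + b * g) ≡ c + 2 * m * a + m * b * (2 * g)
  ring = solve-∀

k+2s+2t≡k+2[s+t] : ∀ k s t → k + 2 * s + 2 * t ≡ k + 2 * (s + t)
k+2s+2t≡k+2[s+t] k s t = trans (+-assoc k (2 * s) (2 * t)) (cong (_+_ k) (sym (*-distribˡ-+ 2 s t)))

∣u[i+2t]-u[i]∣ : ∀ i t → 1 ≤ i → ℤ.∣ u (i + 2 * t) ℤ.- u i ∣ ≡ 3 ^ i * (2 * geom t)
∣u[i+2t]-u[i]∣ i t 1≤i with odd⊎even i 1≤i
... | inj₁ (s , refl) = ∣u[j]-u[i]∣ (1 + 2 * s) (1 + 2 * s + 2 * t) (u[1+2s] s) (begin
  u (1 + 2 * s + 2 * t)   ≡⟨ cong u (k+2s+2t≡k+2[s+t] 1 s t) ⟩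
  u (1 + 2 * (s + t))       ≡⟨ u[1+2s] (s + t) ⟩
  + (2 + 6 * geom (s + t))  ≡⟨ cong +_ (c+2m*geom[s+t] 2 3 s t) ⟩
  + (2 + 6 * geom s + 3 * 9 ^ s * (2 * geom t))
    ≡⟨ cong (λ x → + (2 + 6 * geom s + x * (2 * geom t))) (3^[k+2s] 1 s) ⟨
  + (2 + 6 * geom s + 3 ^ (1 + 2 * s) * (2 * geom t)) ∎)
  where open ≡-Reasoning
... | inj₂ (s , refl) = ∣u[j]-u[i]∣ (2 + 2 * s) (2 + 2 * s + 2 * t) (u[2+2s] s) (begin
  u (2 + 2 * s + 2 * t)   ≡⟨ cong u (k+2s+2t≡k+2[s+t] 2 s t) ⟩
  u (2 + 2 * (s + t))       ≡⟨ u[2+2s] (s + t) ⟩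
  + (1 + 18 * geom (s + t)) ≡⟨ cong +_ (c+2m*geom[s+t] 1 9 s t) ⟩
  + (1 + 18 * geom s + 9 * 9 ^ s * (2 * geom t))
    ≡⟨ cong (λ x → + (1 + 18 * geom s + x * (2 * geom t))) (3^[k+2s] 2 s) ⟨
  + (1 + 18 * geom s + 3 ^ (2 * 1 + 2 * s) * (2 * geom t)) ∎)
  where open ≡-Reasoning

2∣2+6g : ∀ g → 2 ∣ 2 + 6 * g
2∣2+6g g = divides (1 + 3 * g) (factor g)
  where
  factor : ∀ g → 2 + 6 * g ≡ (1 + 3 * g) * 2
  factor = solve-∀

2∤1+18g : ∀ g → ¬ 2 ∣ 1 + 18 * g
2∤1+18g g = subst (λ x → ¬ 2 ∣ 1 + x) (sym (*-assoc 2 9 g)) (2∤1+2k (9 * g))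

∣u[i+1+2t]-u[i]∣-odd : ∀ i t → 1 ≤ i → ¬ 2 ∣ ℤ.∣ u (i + suc (2 * t)) ℤ.- u i ∣
∣u[i+1+2t]-u[i]∣-odd i t 1≤i with odd⊎even i 1≤i
... | inj₁ (s , refl) = subst (λ x → ¬ 2 ∣ x)
  (trans (ℤ.∣i-j∣≡∣j-i∣ (+ (2 + 6 * geom s)) (+ (1 + 18 * geom (s + t)))) (sym (cong₂ (λ x y → ℤ.∣ x ℤ.- y ∣) (trans (cong u index) (u[2+2s] (s + t))) (u[1+2s] s))))
  (∣+a-+b∣-odd (2∣2+6g (geom s)) (2∤1+18g (geom (s + t))))
  where
  index : 1 + 2 * s + suc (2 * t) ≡ 2 + 2 * (s + t)
  index = ring s t
    where
    ring : ∀ s t → 1 + 2 * s + suc (2 * t) ≡ 2 + 2 * (s + t)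
    ring = solve-∀
... | inj₂ (s , refl) = subst (λ x → ¬ 2 ∣ x)
  (sym (cong₂ (λ x y → ℤ.∣ x ℤ.- y ∣) (trans (cong u index) (u[1+2s] (suc (s + t)))) (u[2+2s] s)))
  (∣+a-+b∣-odd (2∣2+6g (geom (suc (s + t)))) (2∤1+18g (geom s)))
  where
  index : 2 + 2 * s + suc (2 * t) ≡ 1 + 2 * suc (s + t)
  index = ring s t
    where
    ring : ∀ s t → 2 + 2 * s + suc (2 * t) ≡ 1 + 2 * suc (s + t)
    ring = solve-∀


-- Moduli separating u₁, …, uₙ

collision⇒¬PI : ∀ {n d} j t → 1 ≤ j → 1 ≤ t → j + 2 * t ≤ n → d ∣ 3 ^ j * (2 * geom t) →
                ¬ PairwiseIncongruent n d
collision⇒¬PI {d = d} j t 1≤j 1≤t j+2t≤n d∣ pi =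
  pi (j + 2 * t) j (≤-trans 1≤j (m≤m+n j _)) j+2t≤n 1≤j (≤-trans (m≤m+n j _) j+2t≤n) j+2t≢j
     (subst (d ∣_) (sym (∣u[i+2t]-u[i]∣ j t 1≤j)) d∣)
  where
  j+2t≢j : j + 2 * t ≢ j
  j+2t≢j = ≢-sym (<⇒≢ (m<m+n j (≤-trans 1≤t (m≤m+n t _))))

2^K∤∣u[i+d]-u[i]∣ : ∀ {n} K i d → 1 ≤ i → 1 ≤ d → i + d ≤ n → n ≤ 2 ^ K →
                   ¬ 2 ^ K ∣ ℤ.∣ u (i + d) ℤ.- u i ∣
2^K∤∣u[i+d]-u[i]∣ zero    i d 1≤i 1≤d i+d≤n n≤1 _ = <⇒≱ (≤-trans (+-mono-≤ 1≤i 1≤d) i+d≤n) n≤1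
2^K∤∣u[i+d]-u[i]∣ {n} (suc K) i d 1≤i 1≤d i+d≤n n≤2^K 2^K∣ with odd⊎even d 1≤d
... | inj₁ (t , refl) = ∣u[i+1+2t]-u[i]∣-odd i t 1≤i (∣-trans (m∣m*n (2 ^ K)) 2^K∣)
... | inj₂ (s , refl) = <⇒≱ (≤-trans 2^K<i+d (subst (λ k → i + k ≤ n) d≡2t i+d≤n)) n≤2^K
  where
  t = suc s
  d≡2t : 2 + 2 * s ≡ 2 * t
  d≡2t = sym (*-distribˡ-+ 2 1 s)
  swap : ∀ x y → x * (2 * y) ≡ 2 * (x * y)
  swap = solve-∀
  2^K∣t : 2 ^ K ∣ t
  2^K∣t = 2^e∣geom[t]⇒2^e∣t K t (prime-power-cancel prime[2] (2∤3^i i) K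
    (*-cancelˡ-∣ 2 (subst (2 * 2 ^ K ∣_)
      (trans (cong (λ k → ℤ.∣ u (i + k) ℤ.- u i ∣) d≡2t) (trans (∣u[i+2t]-u[i]∣ i t 1≤i) (swap (3 ^ i) (geom t))))
      2^K∣)))
  2^K<i+d : 2 ^ suc K < i + 2 * t
  2^K<i+d = ≤-trans (+-monoʳ-≤ 1 (*-monoʳ-≤ 2 (∣⇒≤ 2^K∣t))) (+-monoˡ-≤ (2 * t) 1≤i)

PI-2^K : ∀ n K → n ≤ 2 ^ K → PairwiseIncongruent n (2 ^ K)
PI-2^K n K n≤2^K i j 1≤i i≤n 1≤j j≤n i≢j 2^K∣ with <-cmp i j
... | tri≈ _ i≡j _ = i≢j i≡j
... | tri< i<j _ _ = 2^K∤∣u[i+d]-u[i]∣ K i (j ∸ i) 1≤i (m<n⇒0<n∸m i<j) (subst (_≤ n) (sym i+d≡j) j≤n) n≤2^K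
  (subst (λ k → 2 ^ K ∣ ℤ.∣ u k ℤ.- u i ∣) (sym i+d≡j) (subst (2 ^ K ∣_) (ℤ.∣i-j∣≡∣j-i∣ (u i) (u j)) 2^K∣))
  where
  i+d≡j : i + (j ∸ i) ≡ j
  i+d≡j = m+[n∸m]≡n (<⇒≤ i<j)
... | tri> _ _ j<i = 2^K∤∣u[i+d]-u[i]∣ K j (i ∸ j) 1≤j (m<n⇒0<n∸m j<i) (subst (_≤ n) (sym j+d≡i) i≤n) n≤2^K
  (subst (λ k → 2 ^ K ∣ ℤ.∣ u k ℤ.- u j ∣) (sym j+d≡i) 2^K∣)
  where
  j+d≡i : j + (i ∸ j) ≡ i
  j+d≡i = m+[n∸m]≡n (<⇒≤ j<i)

power-of-2-between : ∀ n → 1 ≤ n → ∃[ K ] n ≤ 2 ^ K × 2 ^ K < 2 * n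
power-of-2-between (suc zero)    _ = 0 , s≤s z≤n , s≤s (s≤s z≤n)
power-of-2-between (suc (suc n)) _ with power-of-2-between (suc n) (s≤s z≤n)
... | K , 1+n≤2^K , 2^K<2+2n with suc (suc n) ≤? 2 ^ K
...   | yes 2+n≤2^K = K , 2+n≤2^K , ≤-trans 2^K<2+2n (*-monoʳ-≤ 2 (n≤1+n (suc n)))
...   | no  2+n≰2^K = suc K , ≤-trans 2+n≤2[1+n] (*-monoʳ-≤ 2 1+n≤2^K) , *-monoʳ-< 2 (≰⇒> 2+n≰2^K)
  where
  2+n≤2[1+n] : suc (suc n) ≤ 2 * suc n
  2+n≤2[1+n] = s≤s (subst (suc n ≤_) (sym (+-suc n (n + 0))) (s≤s (m≤m+n n _)))

DS+2≤2n : ∀ {n d} → 1 ≤ n → 1 < d → IsDS n d → d + 2 ≤ 2 * n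
DS+2≤2n {n} {d} 1≤n 1<d (_ , _ , minimal) with power-of-2-between n 1≤n
... | K , n≤2^K , 2^K<2n with d≤2^K ← ≮⇒≥ (λ 2^K<d → minimal (2 ^ K) (m^n>0 2 K) 2^K<d (PI-2^K n K n≤2^K))
    with K
... | zero  = ⊥-elim (<⇒≱ 1<d d≤2^K)
... | suc K′ = begin
  d + 2            ≤⟨ +-monoˡ-≤ 2 d≤2^K ⟩
  2 * 2 ^ K′ + 2   ≡⟨ *-distribˡ-+ 2 (2 ^ K′) 1 ⟨
  2 * (2 ^ K′ + 1) ≤⟨ *-monoʳ-≤ 2 (subst (_≤ n) (+-comm 1 (2 ^ K′)) 2^K′<n) ⟩
  2 * n            ∎
  where
  open ≤-Reasoning
  2^K′<n : 2 ^ K′ < n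
  2^K′<n = *-cancelˡ-< 2 (2 ^ K′) n 2^K<2n

-- u (j + 2t) ≡ u j (mod d) with both indices ≤ (d + 3) / 2, which is ≤ n when d = D_S(n) > 1.
Collision : ℕ → Set
Collision d = ∃[ j ] ∃[ t ] 1 ≤ j × 1 ≤ t × 2 * (j + 2 * t) ≤ d + 3 × d ∣ 3 ^ j * (2 * geom t)

DS⇒¬Collision : ∀ {n d} → 1 ≤ n → 1 < d → IsDS n d → ¬ Collision d
DS⇒¬Collision {n} {d} 1≤n 1<d ds@(_ , pi , _) (j , t , 1≤j , 1≤t , 2[j+2t]≤d+3 , d∣) =
  collision⇒¬PI j t 1≤j 1≤t j+2t≤n d∣ pi
  where
  j+2t≤n : j + 2 * t ≤ n
  j+2t≤n = ≤-pred (*-cancelˡ-< 2 (j + 2 * t) (suc n) (begin-strict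
    2 * (j + 2 * t)   ≤⟨ 2[j+2t]≤d+3 ⟩
    d + 3             ≡⟨ +-suc d 2 ⟩
    suc (d + 2)       ≤⟨ s≤s (DS+2≤2n 1≤n 1<d ds) ⟩
    suc (2 * n)       <⟨ n<1+n _ ⟩
    2 + 2 * n         ≡⟨ *-distribˡ-+ 2 1 n ⟨
    2 * suc n         ∎))
    where
    open ≤-Reasoning


-- Which moduli avoid collisions

collision-odd : ∀ {m j T} → 1 ≤ j → 1 ≤ T → m ∣ 3 ^ j * geom T → 2 * (j + 2 * T) ≤ m + 3 → Collision m
collision-odd {j = j} 1≤j 1≤T m∣ bound = j , _ , 1≤j , 1≤T , bound , ∣-trans m∣ (*-monoʳ-∣ (3 ^ j) (n∣m*n 2))

-- The factor 2 ^ (1 + e) of the modulus is absorbed by the period 2 ^ e * T, as 2 ^ e ∣ geom (2 ^ e).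
collision-even : ∀ {m j T} → ¬ 2 ∣ m → 1 ≤ j → 1 ≤ T → m ∣ 3 ^ j * geom T → j + 2 * T ≤ m →
                 ∀ e → Collision (2 ^ suc e * m)
collision-even {m} {j} {T} 2∤m 1≤j 1≤T m∣ j+2T≤m e =
  j , A * T , 1≤j , *-mono-≤ 1≤A 1≤T , bound , divisible
  where
  A = 2 ^ e
  1≤A : 1 ≤ A
  1≤A = m^n>0 2 e
  x = 3 ^ j * geom (A * T)
  A*m∣x : A * m ∣ x
  A*m∣x = coprime-∣⇒*-∣ (odd⇒coprime-2^e 2∤m e)
    (∣n⇒∣m*n (3 ^ j) (∣-trans (2^e∣geom[2^e] e) (geom-∣ (m∣m*n {A} T))))
    (∣-trans m∣ (*-monoʳ-∣ (3 ^ j) (geom-∣ (n∣m*n A))))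
  divisible : 2 ^ suc e * m ∣ 3 ^ j * (2 * geom (A * T))
  divisible = subst₂ _∣_ (sym (*-assoc 2 A m)) (regroup (3 ^ j) (geom (A * T))) (*-monoʳ-∣ 2 A*m∣x)
    where
    regroup : ∀ a b → 2 * (a * b) ≡ a * (2 * b)
    regroup = solve-∀
  bound : 2 * (j + 2 * (A * T)) ≤ 2 ^ suc e * m + 3
  bound = begin
    2 * (j + 2 * (A * T)) ≤⟨ *-monoʳ-≤ 2 (+-monoˡ-≤ (2 * (A * T)) (m≤n*m j A ⦃ >-nonZero 1≤A ⦄)) ⟩
    2 * (A * j + 2 * (A * T)) ≡⟨ cong (2 *_) (sym (factor A j T)) ⟩
    2 * (A * (j + 2 * T)) ≤⟨ *-monoʳ-≤ 2 (*-monoʳ-≤ A j+2T≤m) ⟩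
    2 * (A * m)           ≡⟨ *-assoc 2 A m ⟨
    2 ^ suc e * m         ≤⟨ m≤m+n _ 3 ⟩
    2 ^ suc e * m + 3     ∎
    where
    open ≤-Reasoning
    factor : ∀ a j t → a * (j + 2 * t) ≡ a * j + 2 * (a * t)
    factor = solve-∀

2f+1≤3^f : ∀ f → 2 * f + 1 ≤ 3 ^ f
2f+1≤3^f zero    = ≤-refl
2f+1≤3^f (suc f) = begin
  2 * suc f + 1             ≤⟨ m≤m+n _ (4 * f) ⟩
  2 * suc f + 1 + 4 * f     ≡⟨ regroup f ⟩
  3 * (2 * f + 1)           ≤⟨ *-monoʳ-≤ 3 (2f+1≤3^f f) ⟩
  3 ^ suc f                 ∎
  where
  open ≤-Reasoning
  regroup : ∀ f → 2 * suc f + 1 + 4 * f ≡ 3 * (2 * f + 1)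
  regroup = solve-∀

2[f+2T]≤3^f*q+3 : ∀ f q T → 1 ≤ f → 1 ≤ q → 2 * T ≤ q + 1 → 2 * (f + 2 * T) ≤ 3 ^ f * q + 3
2[f+2T]≤3^f*q+3 (suc f′) (suc q′) T _ _ 2T≤q+1 = begin
  2 * (f + 2 * T)                      ≡⟨ *-distribˡ-+ 2 f (2 * T) ⟩
  2 * f + 2 * (2 * T)                  ≤⟨ +-monoʳ-≤ (2 * f) (*-monoʳ-≤ 2 2T≤q+1) ⟩
  2 * f + 2 * (q + 1)                  ≤⟨ m≤m+n _ (2 * f′ * q′ + q′) ⟩
  2 * f + 2 * (q + 1) + (2 * f′ * q′ + q′) ≡⟨ regroup f′ q′ ⟩
  (2 * f + 1) * q + 3                  ≤⟨ +-monoˡ-≤ 3 (*-monoˡ-≤ q (2f+1≤3^f f)) ⟩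
  3 ^ f * q + 3                        ∎
  where
  open ≤-Reasoning
  f = suc f′
  q = suc q′
  regroup : ∀ f′ q′ → 2 * suc f′ + 2 * (suc q′ + 1) + (2 * f′ * q′ + q′) ≡ (2 * suc f′ + 1) * suc q′ + 3
  regroup = solve-∀

collision-3^[1+f] : ∀ e f q → 1 ≤ f → 1 ≤ q → ¬ 2 ∣ q → ¬ 3 ∣ q → Collision (2 ^ e * (3 ^ f * q))
collision-3^[1+f] e f q 1≤f 1≤q 2∤q 3∤q with half-period q 1≤q 2∤q 3∤q
... | T , 1≤T , q∣geom , 2T≤q+1 = collision-2^e*m e
  where
  m = 3 ^ f * q
  m∣3^f*geom : m ∣ 3 ^ f * geom T
  m∣3^f*geom = *-monoʳ-∣ (3 ^ f) q∣geom
  bound : 2 * (f + 2 * T) ≤ m + 3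
  bound = 2[f+2T]≤3^f*q+3 f q T 1≤f 1≤q 2T≤q+1
  2∤m : ¬ 2 ∣ m
  2∤m 2∣m with euclidsLemma (3 ^ f) q prime[2] 2∣m
  ... | inj₁ 2∣3^f = 2∤3^i f 2∣3^f
  ... | inj₂ 2∣q   = 2∤q 2∣q
  3≤m : 3 ≤ m
  3≤m = ≤-trans (+-monoˡ-≤ 1 (*-monoʳ-≤ 2 1≤f)) (≤-trans (2f+1≤3^f f) (m≤m*n (3 ^ f) q ⦃ >-nonZero 1≤q ⦄))
  f+2T≤m : f + 2 * T ≤ m
  f+2T≤m = *-cancelˡ-≤ 2 (≤-trans bound (≤-trans (+-monoʳ-≤ m 3≤m) (≤-reflexive (sym (twice m)))))
    where
    twice : ∀ m → 2 * m ≡ m + m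
    twice = solve-∀
  collision-2^e*m : ∀ e → Collision (2 ^ e * m)
  collision-2^e*m zero     = subst Collision (sym (*-identityˡ m)) (collision-odd 1≤f 1≤T m∣3^f*geom bound)
  collision-2^e*m (suc e′) = collision-even 2∤m 1≤f 1≤T m∣3^f*geom f+2T≤m e′

collision⊎prime-power : ∀ e q → 2 ≤ q → ¬ 2 ∣ q → ¬ 3 ∣ q → Collision (2 ^ e * q) ⊎ (e ≡ 0 × PrimePower q)
collision⊎prime-power e q 2≤q 2∤q 3∤q with short-period q 2≤q 2∤q 3∤q
... | T , 1≤T , q∣8geom , 1+2T≤q , primePower⊎4T≤q = cases e primePower⊎4T≤q
  where
  q∣3geom : q ∣ 3 ^ 1 * geom T
  q∣3geom = ∣n⇒∣m*n (3 ^ 1) (odd⇒∣8geom⇒∣geom {T = T} 2∤q q∣8geom)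
  bound : 4 * T ≤ q → 2 * (1 + 2 * T) ≤ q + 3
  bound 4T≤q = begin
    2 * (1 + 2 * T) ≡⟨ expand T ⟩
    2 + 4 * T       ≤⟨ +-monoʳ-≤ 2 4T≤q ⟩
    2 + q           ≡⟨ +-comm 2 q ⟩
    q + 2           ≤⟨ +-monoʳ-≤ q (n≤1+n 2) ⟩
    q + 3           ∎
    where
    open ≤-Reasoning
    expand : ∀ T → 2 * (1 + 2 * T) ≡ 2 + 4 * T
    expand = solve-∀
  cases : ∀ e → PrimePower q ⊎ 4 * T ≤ q → Collision (2 ^ e * q) ⊎ (e ≡ 0 × PrimePower q)
  cases (suc e′) _             = inj₁ (collision-even 2∤q ≤-refl 1≤T q∣3geom 1+2T≤q e′)
  cases zero     (inj₁ pp)     = inj₂ (refl , pp)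
  cases zero     (inj₂ 4T≤q)   = inj₁ (subst Collision (sym (*-identityˡ q)) (collision-odd ≤-refl 1≤T q∣3geom (bound 4T≤q)))

PowerOfPrime≢3 : ℕ → Set
PowerOfPrime≢3 d = (∃[ e ] 1 ≤ e × d ≡ 2 ^ e) ⊎ (∃[ p ] ∃[ a ] Prime p × 3 < p × d ≡ p ^ suc a)

classify-2^e*3^f*q : ∀ e f q → 1 < 2 ^ e * (3 ^ f * q) → ¬ Collision (2 ^ e * (3 ^ f * q)) → ¬ 2 ∣ q → ¬ 3 ∣ q →
            PowerOfPrime≢3 (2 ^ e * (3 ^ f * q))
classify-2^e*3^f*q e       zero    zero             _   _          2∤q _   = ⊥-elim (2∤q (divides 0 refl))
classify-2^e*3^f*q zero    zero    (suc zero)       1<1 _          _   _   = ⊥-elim (<-irrefl refl 1<1)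
classify-2^e*3^f*q (suc e) zero    (suc zero)       _   _          _   _   = inj₁ (suc e , s≤s z≤n , *-identityʳ (2 ^ suc e))
classify-2^e*3^f*q e       zero    q@(suc (suc _))  _   ¬collision 2∤q 3∤q
  with collision⊎prime-power e q (s≤s (s≤s z≤n)) 2∤q 3∤q
... | inj₁ collision = ⊥-elim (¬collision (subst (λ m → Collision (2 ^ e * m)) (sym (*-identityˡ q)) collision))
... | inj₂ (refl , p , suc a , prime-p , _ , q≡p^[1+a]) =
  inj₂ (p , a , prime-p , coprime-6-prime⇒>3 prime-p p∣q 2∤q 3∤q , trans (*-identityˡ (1 * q)) (trans (*-identityˡ q) q≡p^[1+a]))
  where
  p∣q : p ∣ q
  p∣q = subst (p ∣_) (sym q≡p^[1+a]) (m∣m*n (p ^ a))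
classify-2^e*3^f*q e       (suc f) q                _   ¬collision 2∤q 3∤q =
  ⊥-elim (¬collision (collision-3^[1+f] e (suc f) q (s≤s z≤n) (n≢0⇒n>0 λ { refl → 2∤q (divides 0 refl) }) 2∤q 3∤q))

classify : ∀ {d} → 1 < d → ¬ Collision d → PowerOfPrime≢3 d
classify {d} 1<d ¬collision with factor-out 2 ≤-refl d (<⇒≤ 1<d)
... | e , m , refl , 2∤m with factor-out 3 (s≤s (s≤s z≤n)) m (n≢0⇒n>0 λ { refl → 2∤m (divides 0 refl) })
... | f , q , refl , 3∤q = classify-2^e*3^f*q e f q 1<d ¬collision (λ 2∣q → 2∤m (∣n⇒∣m*n (3 ^ f) 2∣q)) 3∤q


-- Prime powers p ^ m with p > 3

∣+x-1∣ : ∀ {x k} → x ≡ 1 + 8 * geom k → ℤ.∣ + x ℤ.- + 1 ∣ ≡ 8 * geom k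
∣+x-1∣ {k = k} refl = ∣+[a+d]-+a∣ 1 (8 * geom k)

∣9^k-1∣ : ∀ k → ℤ.∣ (+ 9) ℤ.^ k ℤ.- + 1 ∣ ≡ 8 * geom k
∣9^k-1∣ k = trans (cong (λ x → ℤ.∣ x ℤ.- + 1 ∣) (pos-^ 9 k)) (∣+x-1∣ {k = k} (9^t≡1+8*geom[t] k))

∣3^[2r]-1∣ : ∀ r → ℤ.∣ (+ 3) ℤ.^ (2 * r) ℤ.- + 1 ∣ ≡ 8 * geom r
∣3^[2r]-1∣ r = trans (cong (λ x → ℤ.∣ x ℤ.- + 1 ∣) (pos-^ 3 (2 * r)))
  (∣+x-1∣ {k = r} (trans (sym (^-*-assoc 3 2 r)) (9^t≡1+8*geom[t] r)))

IsOrd9-intro : ∀ {N k} → 1 ≤ k → N ∣ 8 * geom k → (∀ j → 1 ≤ j → j < k → ¬ N ∣ 8 * geom j) → IsOrd9 N k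
IsOrd9-intro {N} {k} 1≤k N∣ minimal = 1≤k , subst (N ∣_) (sym (∣9^k-1∣ k)) N∣ ,
  λ j 1≤j j<k N∣j → minimal j 1≤j j<k (subst (N ∣_) (∣9^k-1∣ j) N∣j)

¬Collision⇒no-short-period : ∀ {d} → ¬ Collision d → ¬ 2 ∣ d → ∀ t → 1 ≤ t → 4 * t ≤ d + 1 → ¬ d ∣ 8 * geom t
¬Collision⇒no-short-period {d} ¬collision 2∤d t 1≤t 4t≤d+1 d∣8geom =
  ¬collision (1 , t , ≤-refl , 1≤t , bound , ∣n⇒∣m*n 3 (∣n⇒∣m*n 2 d∣geom))
  where
  d∣geom : d ∣ geom t
  d∣geom = coprime-divisor (Coprime.sym (odd⇒coprime-2^e 2∤d 3)) d∣8geom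
  bound : 2 * (1 + 2 * t) ≤ d + 3
  bound = subst (_≤ d + 3) (sym (expand t)) (subst (2 + 4 * t ≤_) (trans (+-comm 2 (d + 1)) (+-assoc d 1 2)) (+-monoʳ-≤ 2 4t≤d+1))
    where
    expand : ∀ t → 2 * (1 + 2 * t) ≡ 2 + 4 * t
    expand = solve-∀

module _ {r a : ℕ} (prime-p : Prime (1 + 2 * r)) (1≤r : 1 ≤ r) (3<p : 3 < 1 + 2 * r)
         (¬collision : ¬ Collision ((1 + 2 * r) ^ suc a)) where

  private
    p = 1 + 2 * r

    1≤p^ : ∀ k → 1 ≤ p ^ k
    1≤p^ = m^n>0 p

    p∣8geom[r] : p ∣ 8 * geom r
    p∣8geom[r] = fermat₉ {r = r} prime-p refl (λ p∣3 → <⇒≱ 3<p (∣⇒≤ p∣3))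

    lift : ∀ {t} → p ∣ 8 * geom t → ∀ k → p ^ suc k ∣ 8 * geom (p ^ k * t)
    lift {t} p∣8geom[t] k =
      subst (_∣ 8 * geom (p ^ k * t)) (*-comm (p ^ k) p) (∣8geom-lift^ {t = t} ∣-refl p∣8geom[t] k)

  p^[1+a]-minimal-period : ∀ j → 1 ≤ j → j < p ^ a * r → ¬ p ^ suc a ∣ 8 * geom j
  p^[1+a]-minimal-period = minimal-period (¬Collision⇒no-short-period ¬collision 2∤p^[1+a]) (lift p∣8geom[r] a) 2L≤d+1
    where
    2∤p^[1+a] : ¬ 2 ∣ p ^ suc a
    2∤p^[1+a] 2∣p^[1+a] = <⇒≱ 3<p (≤-trans (≤-reflexive (sym 2≡p)) (n≤1+n 2))
      where
      2≡p = prime∣prime⇒≡ prime[2] prime-p (prime∣p^e⇒∣p prime[2] (suc a) 2∣p^[1+a])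
    2L≤d+1 : 2 * (p ^ a * r) ≤ p ^ suc a + 1
    2L≤d+1 = begin
      2 * (p ^ a * r) ≡⟨ swap (p ^ a) r ⟩
      p ^ a * (2 * r) ≤⟨ *-monoʳ-≤ (p ^ a) (n≤1+n _) ⟩
      p ^ a * p       ≡⟨ *-comm (p ^ a) p ⟩
      p ^ suc a       ≤⟨ m≤m+n _ 1 ⟩
      p ^ suc a + 1   ∎
      where
      open ≤-Reasoning
      swap : ∀ x r → 2 * (x * r) ≡ x * (2 * r)
      swap = solve-∀

  ord₉[p^[1+a]] : IsOrd9 (p ^ suc a) (p ^ a * r)
  ord₉[p^[1+a]] = IsOrd9-intro (*-mono-≤ (1≤p^ a) 1≤r) (lift p∣8geom[r] a) p^[1+a]-minimal-period

  ord₉[p] : IsOrd9 p r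
  ord₉[p] = IsOrd9-intro 1≤r p∣8geom[r] λ j 1≤j j<r p∣8geom[j] →
    p^[1+a]-minimal-period (p ^ a * j) (*-mono-≤ (1≤p^ a) 1≤j) (*-monoʳ-< (p ^ a) ⦃ >-nonZero (1≤p^ a) ⦄ j<r)
      (lift p∣8geom[j] a)

  p²∤8geom[r] : 1 ≤ a → ¬ p * p ∣ 8 * geom r
  p²∤8geom[r] 1≤a p²∣8geom[r] = p^[1+a]-minimal-period (p ^ a′ * r) (*-mono-≤ (1≤p^ a′) 1≤r) smaller lifted
    where
    a′ = a ∸ 1
    a≡1+a′ : a ≡ suc a′
    a≡1+a′ = sym (m+[n∸m]≡n 1≤a)
    smaller : p ^ a′ * r < p ^ a * r
    smaller = *-monoˡ-< r ⦃ >-nonZero 1≤r ⦄ (subst (p ^ a′ <_) (trans (*-comm (p ^ a′) p) (cong (p ^_) (sym a≡1+a′)))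
      (m<m*n (p ^ a′) p ⦃ >-nonZero (1≤p^ a′) ⦄ (≤-trans (s≤s (s≤s z≤n)) 3<p)))
    lifted : p ^ suc a ∣ 8 * geom (p ^ a′ * r)
    lifted = subst (_∣ 8 * geom (p ^ a′ * r)) (trans (regroup (p ^ a′) p) (cong (λ k → p ^ suc k) (sym a≡1+a′)))
      (∣8geom-lift^ {t = r} (m∣m*n p) p²∣8geom[r] a′)
      where
      regroup : ∀ x p → x * (p * p) ≡ p * (p * x)
      regroup = solve-∀

prime-power-orders : ∀ {p a} → Prime p → 3 < p → ¬ Collision (p ^ suc a) →
  IsOrd9 (p ^ suc a) (φ (p ^ suc a) / 2) × IsOrd9 p ((p ∸ 1) / 2)
    × (2 ≤ suc a → ¬ ((+ (p * p)) ℤd.∣ ((+ 3) ℤ.^ (p ∸ 1) ℤ.- + 1)))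
prime-power-orders {p} {a} prime-p 3<p ¬collision with odd-prime prime-p (λ { refl → <⇒≱ 3<p (n≤1+n 2) })
... | r , 1≤r , refl =
  subst (IsOrd9 (p ^ suc a)) (sym φ/2≡) (ord₉[p^[1+a]] {a = a} prime-p 1≤r 3<p ¬collision) ,
  subst (IsOrd9 p) (sym (2x/2≡x r)) (ord₉[p] {a = a} prime-p 1≤r 3<p ¬collision) ,
  λ { (s≤s 1≤a) p²∣ → p²∤8geom[r] {a = a} prime-p 1≤r 3<p ¬collision 1≤a (subst (p * p ∣_) (∣3^[2r]-1∣ r) p²∣) }
  where
  2x/2≡x : ∀ x → 2 * x / 2 ≡ x
  2x/2≡x x = trans (cong (_/ 2) (*-comm 2 x)) (m*n/n≡m x 2)
  φ/2≡ : φ (p ^ suc a) / 2 ≡ p ^ a * r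
  φ/2≡ = trans (cong (_/ 2) (trans (φ[p^[1+a]] prime-p a) (x*[2*r]≡2*[x*r] (p ^ a) r))) (2x/2≡x (p ^ a * r))
    where
    x*[2*r]≡2*[x*r] : ∀ x r → x * (2 * r) ≡ 2 * (x * r)
    x*[2*r]≡2*[x*r] = solve-∀

lemma13 : ∀ (n d : ℕ) → 1 ≤ n → 1 < d → IsDS n d →
  ∃[ p ] ∃[ m ] (Prime p × (p ≡ 2 ⊎ 3 < p) × 1 ≤ m × d ≡ p ^ m
    × (3 < p → IsOrd9 (p ^ m) (φ (p ^ m) / 2) × IsOrd9 p ((p ∸ 1) / 2)
        × (2 ≤ m → ¬ ((+ (p * p)) ℤd.∣ ((+ 3) ℤ.^ (p ∸ 1) ℤ.- + 1)))))
lemma13 n d 1≤n 1<d ds with classify 1<d (DS⇒¬Collision 1≤n 1<d ds)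
... | inj₁ (e , 1≤e , d≡2^e) = 2 , e , prime[2] , inj₁ refl , 1≤e , d≡2^e , λ { (s≤s (s≤s ())) }
... | inj₂ (p , a , prime-p , 3<p , refl) = p , suc a , prime-p , inj₂ 3<p , s≤s z≤n , refl ,
  λ _ → prime-power-orders prime-p 3<p (DS⇒¬Collision 1≤n 1<d ds)
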